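{- Let $r\geq2$ and $1\leq i\leq r-1$. The map $(f_u)_{u\geq0}\mapsto(f_0,f_1-1,f_2,f_3,\ldots)$ (removing one part equal to $1$) is a bijection from $\mathcal{U}_{i+1,r}\setminus\tilde{\mathcal{U}}_{i,r}$ onto $\tilde{\mathcal{U}}_{i,r}\setminus\mathcal{U}_{i-1,r}$, and it decreases the weight by $1$.
   Context: Partitions are non-increasing sequences $(\lambda_1,\ldots,\lambda_\ell)$ of positive integers, identified with multiplicity sequences $(f_u)_{u\geq0}$ ($f_u$ = number of parts equal to $u$, $f_0=0$); weight $=\sum_u uf_u$. For $1\leq k\leq r$: $\mathcal{U}_{k,r}$ is the set of partitions with $\lambda_j-\lambda_{j+r-1}\geq2$ for all $j$, $\lambda_j-\lambda_{j+r-2}\leq1$ only if $\lambda_j+\cdots+\lambda_{j+r-2}\equiv k-1\pmod2$, and at most $k-1$ parts equal to $1$; $\tilde{\mathcal{U}}_{k,r}$ is defined the same way but with the congruence $\equiv k\pmod 2$. By convention $\mathcal{U}_{0,r}=\emptyset$. -}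

module Defs where

open import Data.Nat using (ℕ; zero; suc; _+_; _∸_; _≤_; _<_; _≥_; _≡ᵇ_)
open import Data.Nat.DivMod using (_%_)
open import Data.List using (List; []; _∷_; length)
open import Data.Nat.ListAction using (sum)
open import Data.Bool using (true; false)
open import Data.List.Relation.Unary.All using (All)
open import Data.List.Relation.Unary.Linked using (Linked)
open import Data.Product using (_×_)
open import Data.Empty using (⊥)
open import Relation.Binary.PropositionalEquality using (_≡_)

IsPartition : List ℕ → Set
IsPartition λs = Linked _≥_ λs × All (λ x → 1 ≤ x) λs

-- 0-indexed access to parts (default 0; only used at in-range indices).
at : List ℕ → ℕ → ℕ
at []       _       = 0
at (x ∷ xs) zero    = x
at (x ∷ xs) (suc j) = at xs j

window : List ℕ → ℕ → ℕ → ℕ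
window λs j zero    = 0
window λs j (suc m) = at λs j + window λs (suc j) m

ones : List ℕ → ℕ
ones []       = 0
ones (x ∷ xs) with x ≡ᵇ 1
... | true  = suc (ones xs)
... | false = ones xs

weight : List ℕ → ℕ
weight = sum

-- The common shape of U_{k,r} and Ũ_{k,r}:
-- parity p is the required residue mod 2, and at most `maxOnes` parts equal 1.
-- Indices are 0-based here; the conditions range over all j for which the
-- parts involved exist.
Cond : (r p maxOnes : ℕ) → List ℕ → Set
Cond r p maxOnes λs =
  IsPartition λs
  × (∀ j → j + (r ∸ 1) < length λs → at λs (j + (r ∸ 1)) + 2 ≤ at λs j)
  × (∀ j → j + (r ∸ 2) < length λs → at λs j ≤ at λs (j + (r ∸ 2)) + 1 →
       window λs j (r ∸ 1) % 2 ≡ p % 2)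
  × ones λs ≤ maxOnes

-- U_{k,r} (with U_{0,r} = ∅): congruence ≡ k-1 (mod 2), at most k-1 ones.
InU : ℕ → ℕ → List ℕ → Set
InU zero    r λs = ⊥
InU (suc k) r λs = Cond r k k λs

-- Ũ_{k,r} for k ≥ 1: congruence ≡ k (mod 2), at most k-1 ones.
-- (Only used with k ≥ 1; for k = 0 we set it empty as well.)
InUt : ℕ → ℕ → List ℕ → Set
InUt zero    r λs = ⊥
InUt (suc k) r λs = Cond r (suc k) k λs

-- remove one part equal to 1 (the first occurrence; in a partition all 1s are
-- at the end, so this is f ↦ (f_0, f_1 - 1, f_2, …) whenever f_1 ≥ 1)
removeOne : List ℕ → List ℕ
removeOne []       = []
removeOne (x ∷ xs) with x ≡ᵇ 1
... | true  = xs
... | false = x ∷ removeOne xs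

{-# OPTIONS --safe #-}
module Submission where

-- Both U_{i+1,r} \ Ũ_{i,r} and Ũ_{i,r} \ U_{i-1,r} impose the parity ≡ i, and
-- they are cut out by the number of ones: exactly i, resp. exactly i-1. In a
-- partition the ones form the final segment, so the map drops the last part
-- and its inverse appends a part 1; what has to be checked is that the
-- conditions survive. Dropping the last part only forgets windows. Appending a
-- 1 to ν creates two new windows, those ending at the new part. Such a window
-- whose first part is at most 2 consists of 1s and 2s and (as ν has i-1 ≤ r-2
-- ones) contains all ones, so its sum has the parity of the number of ones.
-- For the new parity window this is i, as required; for the new gap window,
-- a first part ≤ 2 would make the corresponding window of ν have parity i-1,
-- against the parity condition of ν.

open import Defs
open import Data.Bool using (true; false)
open import Data.Empty using (⊥-elim)
open import Data.List using (List; []; _∷_; _++_; _∷ʳ_; [_]; length; drop)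
open import Data.List.Properties using (length-drop; length-++; length-++-≤ˡ; ∷ʳ-injectiveˡ)
open import Data.List.Relation.Unary.All as All using (All; []; _∷_)
open import Data.List.Relation.Unary.All.Properties using (++⁻ˡ; ∷ʳ⁺; drop⁺)
open import Data.List.Relation.Unary.Linked as Linked using (Linked; []; [-]; _∷_)
open import Data.List.Relation.Unary.Linked.Properties using (Linked⇒All)
open import Data.Nat using (ℕ; zero; suc; _+_; _*_; _∸_; _≤_; _<_; _≡ᵇ_; z≤n; s≤s; z<s; s<s)
open import Data.Nat.Properties
open import Data.Nat.DivMod using (_%_; [m+kn]%n≡m%n)
open import Data.Nat.ListAction using (sum)
open import Data.Nat.ListAction.Properties using (sum-++)
open import Data.Product using (_×_; Σ; ∃-syntax; _,_)
open import Data.Sum as Sum using (_⊎_; inj₁; inj₂)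
open import Function using (id; flip)
open import Relation.Binary.Core using (Rel)
open import Relation.Binary.PropositionalEquality
  using (_≡_; _≢_; refl; sym; trans; cong; cong₂; subst; module ≡-Reasoning)
open import Relation.Nullary using (¬_)

private
  variable
    r n p m j b x : ℕ
    xs ys : List ℕ

Linked-++⁻ˡ : ∀ {a ℓ} {A : Set a} {R : Rel A ℓ} (zs : List A) {ws : List A} →
              Linked R (zs ++ ws) → Linked R zs
Linked-++⁻ˡ []           _         = []
Linked-++⁻ˡ (z ∷ [])     _         = [-]
Linked-++⁻ˡ (z ∷ w ∷ zs) (rel ∷ l) = rel ∷ Linked-++⁻ˡ (w ∷ zs) l

Linked-∷ʳ⁺ : ∀ {a ℓ} {A : Set a} {R : Rel A ℓ} {zs : List A} {w : A} →
             Linked R zs → All (λ z → R z w) zs → Linked R (zs ∷ʳ w)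
Linked-∷ʳ⁺ []        []         = [-]
Linked-∷ʳ⁺ [-]       (rel ∷ []) = rel ∷ [-]
Linked-∷ʳ⁺ (rel ∷ l) (_ ∷ rels) = rel ∷ Linked-∷ʳ⁺ l rels

∷ʳ-All≡ : All (_≡ x) xs → xs ∷ʳ x ≡ x ∷ xs
∷ʳ-All≡ []          = refl
∷ʳ-All≡ (refl ∷ ps) = cong (_ ∷_) (∷ʳ-All≡ ps)

All-at : ∀ {P : ℕ → Set} → All P xs → j < length xs → P (at xs j)
All-at {j = zero}  (px ∷ _)  _       = px
All-at {j = suc j} (_ ∷ pxs) (s<s h) = All-at pxs h

length-drop-≤ : ∀ j (xs : List ℕ) → length (drop j xs) ≤ length xs
length-drop-≤ j xs = ≤-trans (≤-reflexive (length-drop j xs)) (m∸n≤m (length xs) j)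

<-length-∷ʳ : ∀ xs → j < length (xs ∷ʳ x) → j < length xs ⊎ j ≡ length xs
<-length-∷ʳ {zero}  []       _         = inj₂ refl
<-length-∷ʳ {suc j} []       (s<s ())
<-length-∷ʳ {zero}  (_ ∷ xs) _         = inj₁ z<s
<-length-∷ʳ {suc j} (_ ∷ xs) (s<s h)   = Sum.map s<s (cong suc) (<-length-∷ʳ xs h)

at-++ˡ : ∀ xs → j < length xs → at (xs ++ ys) j ≡ at xs j
at-++ˡ {zero}  (_ ∷ xs) _       = refl
at-++ˡ {suc j} (_ ∷ xs) (s<s h) = at-++ˡ xs h

at-∷ʳ-length : ∀ xs → at (xs ∷ʳ x) (length xs) ≡ x
at-∷ʳ-length []       = refl
at-∷ʳ-length (_ ∷ xs) = at-∷ʳ-length xs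

window-∷ : ∀ j m → window (x ∷ xs) (suc j) m ≡ window xs j m
window-∷ j zero    = refl
window-∷ {xs = xs} j (suc m) = cong (at xs j +_) (window-∷ (suc j) m)

window-++ˡ : ∀ xs j m → j + m ≤ length xs → window (xs ++ ys) j m ≡ window xs j m
window-++ˡ xs j zero    _ = refl
window-++ˡ xs j (suc m) h =
  cong₂ _+_ (at-++ˡ xs (<-≤-trans (m<m+n j z<s) h))
            (window-++ˡ xs (suc j) m (subst (_≤ length xs) (+-suc j m) h))

window-suffix : ∀ xs j m → length xs ≡ j + m → window xs j m ≡ sum (drop j xs)
window-suffix []       zero    zero    _ = refl
window-suffix (x ∷ xs) zero    (suc m) h =
  cong (x +_) (trans (window-∷ 0 m) (window-suffix xs 0 m (suc-injective h)))
window-suffix (x ∷ xs) (suc j) m       h =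
  trans (window-∷ j m) (window-suffix xs j m (suc-injective h))

ones-∷ʳ1 : ∀ xs → ones (xs ∷ʳ 1) ≡ suc (ones xs)
ones-∷ʳ1 []       = refl
ones-∷ʳ1 (x ∷ xs) with x ≡ᵇ 1
... | true  = cong suc (ones-∷ʳ1 xs)
... | false = ones-∷ʳ1 xs

ones-All≡1 : All (_≡ 1) xs → ones xs ≡ length xs
ones-All≡1 []          = refl
ones-All≡1 (refl ∷ ps) = cong suc (ones-All≡1 ps)

sum≡ones+k*2 : All (1 ≤_) xs → All (_≤ 2) xs → ∃[ k ] sum xs ≡ ones xs + k * 2
sum≡ones+k*2                         []        []                 = 0 , refl
sum≡ones+k*2 {zero ∷ _}              (() ∷ _)  _
sum≡ones+k*2 {1 ∷ _}                 (_ ∷ pos) (_ ∷ ≤2)           with sum≡ones+k*2 pos ≤2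
... | k , e = k , cong suc e
sum≡ones+k*2 {2 ∷ xs}                (_ ∷ pos) (_ ∷ ≤2)           with sum≡ones+k*2 pos ≤2
... | k , e = suc k , trans (cong (2 +_) e)
                        (sym (trans (+-suc (ones xs) _) (cong suc (+-suc (ones xs) _))))
sum≡ones+k*2 {suc (suc (suc _)) ∷ _} _         (s≤s (s≤s ()) ∷ _)

sum%2≡ones%2 : All (1 ≤_) xs → All (_≤ 2) xs → sum xs % 2 ≡ ones xs % 2
sum%2≡ones%2 {xs} pos ≤2 with sum≡ones+k*2 pos ≤2
... | k , e = trans (cong (_% 2) e) ([m+kn]%n≡m%n (ones xs) k 2)

n%2≢[1+n]%2 : ∀ n → n % 2 ≢ suc n % 2
n%2≢[1+n]%2 0             ()
n%2≢[1+n]%2 1             ()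
n%2≢[1+n]%2 (suc (suc n)) = n%2≢[1+n]%2 n

IsPartition-tail : IsPartition (x ∷ xs) → IsPartition xs
IsPartition-tail (l , _ ∷ pos) = Linked.tail l , pos

IsPartition-++⁻ˡ : ∀ xs → IsPartition (xs ++ ys) → IsPartition xs
IsPartition-++⁻ˡ xs (l , pos) = Linked-++⁻ˡ xs l , ++⁻ˡ xs pos

IsPartition-∷ʳ1 : IsPartition xs → IsPartition (xs ∷ʳ 1)
IsPartition-∷ʳ1 (l , pos) = Linked-∷ʳ⁺ l pos , ∷ʳ⁺ pos ≤-refl

drop-bounded : ∀ j → IsPartition xs → at xs j ≤ b → All (_≤ b) (drop j xs)
drop-bounded {[]}     zero    _       _   = []
drop-bounded {x ∷ xs} zero    (l , _) x≤b = Linked⇒All (flip ≤-trans) x≤b l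
drop-bounded {[]}     (suc j) _       _   = []
drop-bounded {x ∷ xs} (suc j) P       h   = drop-bounded j (IsPartition-tail P) h

IsPartition-1∷⇒All≡1 : IsPartition (1 ∷ xs) → All (_≡ 1) xs
IsPartition-1∷⇒All≡1 P@(_ , _ ∷ pos) =
  All.zipWith (λ (1≤y , y≤1) → ≤-antisym y≤1 1≤y) (pos , All.tail (drop-bounded 0 P ≤-refl))

ones-drop : ∀ j → IsPartition xs → ones xs ≤ length (drop j xs) → ones (drop j xs) ≡ ones xs
ones-drop                   zero    _                _ = refl
ones-drop {[]}              (suc j) _                _ = refl
ones-drop {zero ∷ _}        (suc j) (_ , () ∷ _)     _
ones-drop {1 ∷ xs}          (suc j) P                h =
  ⊥-elim (n≮n (length xs) (begin-strict
    length xs               <⟨ n<1+n (length xs) ⟩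
    suc (length xs)         ≡⟨ cong suc (ones-All≡1 (IsPartition-1∷⇒All≡1 P)) ⟨
    ones (1 ∷ xs)           ≤⟨ h ⟩
    length (drop j xs)      ≤⟨ length-drop-≤ j xs ⟩
    length xs               ∎))
  where open ≤-Reasoning
ones-drop {suc (suc _) ∷ _} (suc j) P                h = ones-drop j (IsPartition-tail P) h

removeOne-∷ʳ : IsPartition xs → 1 ≤ ones xs → removeOne xs ∷ʳ 1 ≡ xs
removeOne-∷ʳ {[]}              _            ()
removeOne-∷ʳ {zero ∷ _}        (_ , () ∷ _) _
removeOne-∷ʳ {1 ∷ _}           P            _ = ∷ʳ-All≡ (IsPartition-1∷⇒All≡1 P)
removeOne-∷ʳ {suc (suc x) ∷ _} P            h =
  cong (suc (suc x) ∷_) (removeOne-∷ʳ (IsPartition-tail P) h)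

removeOne-∷ʳ1 : IsPartition xs → removeOne (xs ∷ʳ 1) ≡ xs
removeOne-∷ʳ1 {xs} P = ∷ʳ-injectiveˡ (removeOne (xs ∷ʳ 1)) xs
  (removeOne-∷ʳ (IsPartition-∷ʳ1 P) (subst (1 ≤_) (sym (ones-∷ʳ1 xs)) (s≤s z≤n)))

final-window%2≡ones%2 : IsPartition xs → length xs ≡ j + m → at xs j ≤ 2 → ones xs ≤ m →
                        window xs j m % 2 ≡ ones xs % 2
final-window%2≡ones%2 {xs} {j} {m} P@(_ , pos) len xⱼ≤2 ones≤m = begin
  window xs j m % 2     ≡⟨ cong (_% 2) (window-suffix xs j m len) ⟩
  sum (drop j xs) % 2   ≡⟨ sum%2≡ones%2 (drop⁺ j pos) (drop-bounded j P xⱼ≤2) ⟩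
  ones (drop j xs) % 2  ≡⟨ cong (_% 2) (ones-drop j P ones≤suffix-length) ⟩
  ones xs % 2           ∎
  where
  open ≡-Reasoning
  suffix-length : length (drop j xs) ≡ m
  suffix-length = trans (length-drop j xs) (trans (cong (_∸ j) len) (m+n∸m≡n j m))
  ones≤suffix-length : ones xs ≤ length (drop j xs)
  ones≤suffix-length = subst (ones xs ≤_) (sym suffix-length) ones≤m

Gap : ℕ → List ℕ → ℕ → Set
Gap r xs j = at xs (j + (r ∸ 1)) + 2 ≤ at xs j

ParityAt : ℕ → ℕ → List ℕ → ℕ → Set
ParityAt r p xs j = at xs j ≤ at xs (j + (r ∸ 2)) + 1 → window xs j (r ∸ 1) % 2 ≡ p % 2

Gap-++ˡ : ∀ xs → j + suc r < length xs → Gap (2 + r) (xs ++ ys) j ≡ Gap (2 + r) xs j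
Gap-++ˡ {j} xs h =
  cong₂ (λ a b → a + 2 ≤ b) (at-++ˡ xs h) (at-++ˡ xs (≤-<-trans (m≤m+n j _) h))

ParityAt-++ˡ : ∀ xs → j + r < length xs →
               ParityAt (2 + r) p (xs ++ ys) j ≡ ParityAt (2 + r) p xs j
ParityAt-++ˡ {j} {r} {p} xs h =
  cong₂ (λ A B → A → B)
    (cong₂ (λ a b → a ≤ b + 1) (at-++ˡ xs (≤-<-trans (m≤m+n j _) h)) (at-++ˡ xs h))
    (cong (λ w → w % 2 ≡ p % 2)
          (window-++ˡ xs j (suc r) (subst (_≤ length xs) (sym (+-suc j r)) h)))

Cond-++⁻ˡ : ∀ xs → Cond (2 + r) p m (xs ++ ys) → ones xs ≤ n → Cond (2 + r) p n xs
Cond-++⁻ˡ {p = p} xs (P , gap , par , _) ones≤n =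
  IsPartition-++⁻ˡ xs P ,
  (λ j h → subst id (Gap-++ˡ xs h) (gap j (<-≤-trans h (length-++-≤ˡ xs)))) ,
  (λ j h → subst id (ParityAt-++ˡ {p = p} xs h) (par j (<-≤-trans h (length-++-≤ˡ xs)))) ,
  ones≤n

final-window-head≥3 : n ≤ r → Cond (2 + r) (suc n) n xs → ones xs ≡ n →
                      j + suc r ≡ length xs → 3 ≤ at xs j
final-window-head≥3 {n} {r} {xs} {j} n≤r (P@(_ , pos) , _ , par , _) ones≡n e = ≮⇒≥ λ xⱼ<3 →
  let xⱼ≤2 = ≤-pred xⱼ<3 in
  n%2≢[1+n]%2 n (begin
    n % 2                    ≡⟨ cong (_% 2) ones≡n ⟨
    ones xs % 2              ≡⟨ final-window%2≡ones%2 P (sym e) xⱼ≤2 ones≤1+r ⟨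
    window xs j (suc r) % 2  ≡⟨ par j last (≤-trans xⱼ≤2 (+-monoˡ-≤ 1 (All-at pos last))) ⟩
    suc n % 2                ∎)
  where
  open ≡-Reasoning
  last : j + r < length xs
  last = subst (j + r <_) (trans (sym (+-suc j r)) e) (n<1+n (j + r))
  ones≤1+r : ones xs ≤ suc r
  ones≤1+r = ≤-trans (≤-reflexive ones≡n) (m≤n⇒m≤1+n n≤r)

Cond-∷ʳ1 : n ≤ r → Cond (2 + r) (suc n) n xs → ones xs ≡ n →
           Cond (2 + r) (suc n) (suc n) (xs ∷ʳ 1)
Cond-∷ʳ1 {n} {r} {xs} n≤r c@(P , gap , par , _) ones≡n = P′ , gap′ , par′ , ≤-reflexive ones′
  where
  P′ : IsPartition (xs ∷ʳ 1)
  P′ = IsPartition-∷ʳ1 P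
  ones′ : ones (xs ∷ʳ 1) ≡ suc n
  ones′ = trans (ones-∷ʳ1 xs) (cong suc ones≡n)
  at-new : ∀ {k} → k ≡ length xs → at (xs ∷ʳ 1) k ≡ 1
  at-new refl = at-∷ʳ-length xs

  gap′ : ∀ j → j + suc r < length (xs ∷ʳ 1) → Gap (2 + r) (xs ∷ʳ 1) j
  gap′ j h with <-length-∷ʳ xs h
  ... | inj₁ old = subst id (sym (Gap-++ˡ xs old)) (gap j old)
  ... | inj₂ new = begin
    at (xs ∷ʳ 1) (j + suc r) + 2  ≡⟨ cong (_+ 2) (at-new new) ⟩
    3                             ≤⟨ final-window-head≥3 n≤r c ones≡n new ⟩
    at xs j                       ≡⟨ at-++ˡ xs (subst (j <_) new (m<m+n j z<s)) ⟨
    at (xs ∷ʳ 1) j                ∎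
    where open ≤-Reasoning

  par′ : ∀ j → j + r < length (xs ∷ʳ 1) → ParityAt (2 + r) (suc n) (xs ∷ʳ 1) j
  par′ j h with <-length-∷ʳ xs h
  ... | inj₁ old = subst id (sym (ParityAt-++ˡ {p = suc n} xs old)) (par j old)
  ... | inj₂ new = λ xⱼ≤xⱼ₊ᵣ+1 →
    trans (final-window%2≡ones%2 P′ length′
             (subst (λ a → at (xs ∷ʳ 1) j ≤ a + 1) (at-new new) xⱼ≤xⱼ₊ᵣ+1)
             (≤-trans (≤-reflexive ones′) (s≤s n≤r)))
          (cong (_% 2) ones′)
    where
    length′ : length (xs ∷ʳ 1) ≡ j + suc r
    length′ = begin
      length (xs ++ [ 1 ])  ≡⟨ length-++ xs ⟩
      length xs + 1         ≡⟨ +-comm (length xs) 1 ⟩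
      suc (length xs)       ≡⟨ cong suc new ⟨
      suc (j + r)           ≡⟨ +-suc j r ⟨
      j + suc r             ∎
      where open ≡-Reasoning

InU⇒ones< : ∀ {k} → InU k r xs → ones xs < k
InU⇒ones< {k = suc k} (_ , _ , _ , ones≤k) = s≤s ones≤k

InUt⇒ones< : ∀ {k} → InUt k r xs → ones xs < k
InUt⇒ones< {k = suc k} (_ , _ , _ , ones≤k) = s≤s ones≤k

ones-exact : Cond r p (suc n) xs → ¬ Cond r p n xs → ones xs ≡ suc n
ones-exact (P , gap , par , ones≤1+n) ¬c =
  ≤-antisym ones≤1+n (≰⇒> λ ones≤n → ¬c (P , gap , par , ones≤n))

-- ¬ InU (suc n) is ¬ Cond r n n, accepted as ¬ Cond r (2 + n) n because
-- n % 2 and (2 + n) % 2 are definitionally equal.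
Ũ∖U⇒ones≡ : InUt (suc n) r xs → ¬ InU n r xs → ones xs ≡ n
Ũ∖U⇒ones≡ {zero}  (_ , _ , _ , ones≤0) _  = n≤0⇒n≡0 ones≤0
Ũ∖U⇒ones≡ {suc n} {r} c                 ¬u = ones-exact {r} {2 + n} c ¬u

U∖Ũ⇒removeOne-∷ʳ : InU (2 + n) r xs → ¬ InUt (suc n) r xs → removeOne xs ∷ʳ 1 ≡ xs
U∖Ũ⇒removeOne-∷ʳ {n} {r} c@(P , _) ¬c =
  removeOne-∷ʳ P (subst (1 ≤_) (sym (ones-exact {r} {suc n} c ¬c)) (s≤s z≤n))

removeOne-U∖Ũ→Ũ∖U : (xs : List ℕ) → InU (2 + n) (2 + r) xs → ¬ InUt (suc n) (2 + r) xs →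
  1 ≤ ones xs
  × (InUt (suc n) (2 + r) (removeOne xs) × ¬ InU n (2 + r) (removeOne xs))
  × weight (removeOne xs) + 1 ≡ weight xs
removeOne-U∖Ũ→Ũ∖U {n} {r} xs c ¬c = subst (1 ≤_) (sym ones≡) (s≤s z≤n) , (inŨ , ¬inU) , weight≡
  where
  ν = removeOne xs
  ones≡ : ones xs ≡ suc n
  ones≡ = ones-exact {2 + r} {suc n} c ¬c
  ν∷ʳ1≡xs : ν ∷ʳ 1 ≡ xs
  ν∷ʳ1≡xs = U∖Ũ⇒removeOne-∷ʳ {n} {2 + r} c ¬c
  onesν : ones ν ≡ n
  onesν = suc-injective (trans (sym (ones-∷ʳ1 ν)) (trans (cong ones ν∷ʳ1≡xs) ones≡))
  inŨ : InUt (suc n) (2 + r) ν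
  inŨ = Cond-++⁻ˡ {r} {suc n} ν (subst (Cond (2 + r) (suc n) (suc n)) (sym ν∷ʳ1≡xs) c)
                                (≤-reflexive onesν)
  ¬inU : ¬ InU n (2 + r) ν
  ¬inU u = <-irrefl onesν (InU⇒ones< {2 + r} u)
  weight≡ : weight ν + 1 ≡ weight xs
  weight≡ = trans (sym (sum-++ ν [ 1 ])) (cong sum ν∷ʳ1≡xs)

removeOne-injective-on-U∖Ũ : (xs ys : List ℕ) →
  InU (2 + n) r xs → ¬ InUt (suc n) r xs → InU (2 + n) r ys → ¬ InUt (suc n) r ys →
  removeOne xs ≡ removeOne ys → xs ≡ ys
removeOne-injective-on-U∖Ũ {n} {r} xs ys cx ¬cx cy ¬cy e = begin
  xs                  ≡⟨ U∖Ũ⇒removeOne-∷ʳ {n} {r} cx ¬cx ⟨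
  removeOne xs ∷ʳ 1   ≡⟨ cong (_∷ʳ 1) e ⟩
  removeOne ys ∷ʳ 1   ≡⟨ U∖Ũ⇒removeOne-∷ʳ {n} {r} cy ¬cy ⟩
  ys                  ∎
  where open ≡-Reasoning

removeOne-surjective-onto-Ũ∖U : n ≤ r → (ν : List ℕ) →
  InUt (suc n) (2 + r) ν → ¬ InU n (2 + r) ν →
  Σ (List ℕ) (λ xs → (InU (2 + n) (2 + r) xs × ¬ InUt (suc n) (2 + r) xs) × removeOne xs ≡ ν)
removeOne-surjective-onto-Ũ∖U {n} {r} n≤r ν c@(P , _) ¬u =
  ν ∷ʳ 1 , (Cond-∷ʳ1 n≤r c onesν , ¬inŨ) , removeOne-∷ʳ1 P
  where
  onesν : ones ν ≡ n
  onesν = Ũ∖U⇒ones≡ {n} {2 + r} c ¬u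
  ¬inŨ : ¬ InUt (suc n) (2 + r) (ν ∷ʳ 1)
  ¬inŨ w = <-irrefl (trans (ones-∷ʳ1 ν) (cong suc onesν)) (InUt⇒ones< {2 + r} w)

mainTheorem7 : (r i : ℕ) → 2 ≤ r → 1 ≤ i → i ≤ r ∸ 1 →
    -- well-defined: every λ in U_{i+1,r} \ Ũ_{i,r} has a part 1, its image
    -- lies in Ũ_{i,r} \ U_{i-1,r}, and the weight drops by 1
    ((λs : List ℕ) → InU (suc i) r λs → ¬ InUt i r λs →
       1 ≤ ones λs
       × (InUt i r (removeOne λs) × ¬ InU (i ∸ 1) r (removeOne λs))
       × weight (removeOne λs) + 1 ≡ weight λs)
    -- injective on U_{i+1,r} \ Ũ_{i,r}
    × ((λs μs : List ℕ) → InU (suc i) r λs → ¬ InUt i r λs →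
         InU (suc i) r μs → ¬ InUt i r μs →
         removeOne λs ≡ removeOne μs → λs ≡ μs)
    -- surjective onto Ũ_{i,r} \ U_{i-1,r}
    × ((νs : List ℕ) → InUt i r νs → ¬ InU (i ∸ 1) r νs →
         Σ (List ℕ) (λ λs → (InU (suc i) r λs × ¬ InUt i r λs)
                           × removeOne λs ≡ νs))
mainTheorem7 (suc (suc r)) (suc n) _ _ (s≤s n≤r) =
  removeOne-U∖Ũ→Ũ∖U , removeOne-injective-on-U∖Ũ {n} {2 + r} , removeOne-surjective-onto-Ũ∖U n≤r
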